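{- Let $p$ be a prime and let $k$, $c$, $d$ be integers with $1 \leq k \leq c \leq d < c+d \leq p$. For every integer $\ell \in [1, c+d+1-k]$ let \[C(\ell)=\sum_{j=1}^{c+1-k} \binom{k+j-2}{k-1}\binom{c+d-k}{d+j-1}\binom{p-c-d+2k-2}{k+j-1-\ell}.\] Then for every integer $\ell\in[1,c+d+1-k]$, \[C(\ell)=\sum_{r=0}^{k-1}(-1)^r\binom{c-1-r}{k-1-r}\binom{c+d-k}{r}\binom{p+k-r-2}{c-\ell-r}.\]
   Context: Binomial coefficients follow the convention: for an integer $n$ and an integer $m\ge 0$, $\binom{n}{m}=n(n-1)\cdots(n-m+1)/m!$, and $\binom{n}{m}=0$ for integers $m<0$. -}

module Defs where

open import Data.Nat using (ℕ; zero; suc; _∸_) renaming (_+_ to _+ℕ_)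
open import Data.Nat.Combinatorics using (_C_)
open import Data.Integer using (ℤ; +_; -[1+_]; _+_; _-_; _*_; -_)
open import Data.List using (List; map; foldr; upTo)

sgn : ℕ → ℤ
sgn zero = + 1
sgn (suc m) = - sgn m

-- Generalized binomial coefficient binom n m for integers n, m:
-- n(n-1)...(n-m+1)/m! for m ≥ 0, and 0 for m < 0.
-- For n = -(a+1) < 0 this equals (-1)^m * C(a+m, m).
binom : ℤ → ℤ → ℤ
binom (+ a)    (+ m)    = + (a C m)
binom -[1+ a ] (+ m)    = sgn m * + ((a +ℕ m) C m)
binom _        -[1+ _ ] = + 0

sumFromTo : ℕ → ℕ → (ℕ → ℤ) → ℤ
sumFromTo a b f = foldr _+_ (+ 0) (map (λ i → f (a +ℕ i)) (upTo (suc b ∸ a)))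

Cfun : ℕ → ℕ → ℕ → ℕ → ℕ → ℤ
Cfun p c d k ℓ =
  sumFromTo 1 (suc c ∸ k) λ j →
    binom (+ k + + j - + 2) (+ k - + 1)
    * binom (+ c + + d - + k) (+ d + + j - + 1)
    * binom (+ p - + c - + d + + 2 * + k - + 2) (+ k + + j - + 1 - + ℓ)

RHS : ℕ → ℕ → ℕ → ℕ → ℕ → ℤ
RHS p c d k ℓ =
  sumFromTo 0 (k ∸ 1) λ r →
    sgn r
    * binom (+ c - + 1 - + r) (+ k - + 1 - + r)
    * binom (+ c + + d - + k) (+ r)
    * binom (+ p + + k - + r - + 2) (+ c - + ℓ - + r)

{-# OPTIONS --safe #-}
module Submission where

-- Substituting s = c - k + 1 - j turns C(ℓ) into
--   Σ_s binom(N, s) binom(A, c - ℓ - s) binom(c - 1 - s, k - 1),  N = c + d - k,  A = p - c - d + 2k - 2.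
-- On the right p + k - r - 2 = (N - r) + A, so Vandermonde's convolution splits the last factor
-- over binom(N - r, i); the trinomial rule binom(N, r) binom(N - r, i) = binom(N, r + i) binom(r + i, r)
-- and an exchange of summations then leave, for each s = r + i, the alternating sum
--   Σ_r (-1)^r binom(s, r) binom(c - 1 - r, k - 1 - r) = binom(c - 1 - s, k - 1),
-- which is Pascal's rule iterated in s.

open import Defs

-- A scope for the integer operators, which would clash with those of ℕ in the statement of proposition2.
module _ where
  open import Data.Nat using (ℕ; zero; suc; z≤n; s≤s; _∸_; _≤_; _<_; _≤?_; _!)
    renaming (_+_ to _+ℕ_; _*_ to _*ℕ_)
  import Data.Nat.Properties as ℕ
  import Data.Nat.Tactic.RingSolver as ℕ-Solver
  open import Data.Nat.Combinatorics
    using (_C_; k>n⇒nCk≡0; nCk≡nC[n∸k]; nCk≡n!/k![n-k]!; k![n∸k]!∣n!; nCk+nC[k+1]≡[n+1]C[k+1])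
  open import Data.Nat.DivMod using (m/n*n≡m)
  open import Data.Integer using (ℤ; +_; -[1+_]; 0ℤ; _+_; _-_; _*_; -_)
  open import Data.Integer.Properties
    using (+-identityˡ; +-identityʳ; +-assoc; +-comm; *-identityˡ; *-zeroʳ; *-assoc; *-distribˡ-+;
           *-distribʳ-+; neg-distrib-+; pos-*; [+m]-[+n]≡m⊖n; ⊖-≥; ⊖-<)
  open import Data.Integer.Tactic.RingSolver using (solve-∀)
  open import Data.List using (foldr; applyUpTo)
  open import Data.List.Properties using (map-upTo)
  open import Data.Product using (_,_)
  open import Relation.Binary.PropositionalEquality
  open import Relation.Nullary using (yes; no)
  open ≡-Reasoning

  ∑< : ℕ → (ℕ → ℤ) → ℤ
  ∑< zero    f = 0ℤ
  ∑< (suc n) f = f 0 + ∑< n (λ i → f (suc i))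

  sumFromTo≡∑< : ∀ a b f → sumFromTo a b f ≡ ∑< (suc b ∸ a) (λ i → f (a +ℕ i))
  sumFromTo≡∑< a b f = trans (cong (foldr _+_ 0ℤ) (map-upTo _ (suc b ∸ a))) (foldr-applyUpTo _ (suc b ∸ a))
    where
    foldr-applyUpTo : ∀ (g : ℕ → ℤ) n → foldr _+_ 0ℤ (applyUpTo g n) ≡ ∑< n g
    foldr-applyUpTo g zero    = refl
    foldr-applyUpTo g (suc n) = cong (_+_ (g 0)) (foldr-applyUpTo (λ i → g (suc i)) n)

  ∑<-cong : ∀ n {f g : ℕ → ℤ} → (∀ i → i < n → f i ≡ g i) → ∑< n f ≡ ∑< n g
  ∑<-cong zero    f≗g = refl
  ∑<-cong (suc n) f≗g = cong₂ _+_ (f≗g 0 (s≤s z≤n)) (∑<-cong n (λ i i<n → f≗g (suc i) (s≤s i<n)))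

  ∑<-≡0 : ∀ n {f : ℕ → ℤ} → (∀ i → i < n → f i ≡ 0ℤ) → ∑< n f ≡ 0ℤ
  ∑<-≡0 zero    f≗0 = refl
  ∑<-≡0 (suc n) f≗0 = cong₂ _+_ (f≗0 0 (s≤s z≤n)) (∑<-≡0 n (λ i i<n → f≗0 (suc i) (s≤s i<n)))

  ∑<-distrib-+ : ∀ n (f g : ℕ → ℤ) → ∑< n (λ i → f i + g i) ≡ ∑< n f + ∑< n g
  ∑<-distrib-+ zero    f g = refl
  ∑<-distrib-+ (suc n) f g =
    trans (cong (_+_ (f 0 + g 0)) (∑<-distrib-+ n _ _)) (interchange (f 0) (g 0) _ _)
    where
    interchange : ∀ (a b x y : ℤ) → (a + b) + (x + y) ≡ (a + x) + (b + y)
    interchange = solve-∀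

  ∑<-distribˡ-* : ∀ n x (f : ℕ → ℤ) → ∑< n (λ i → x * f i) ≡ x * ∑< n f
  ∑<-distribˡ-* zero    x f = sym (*-zeroʳ x)
  ∑<-distribˡ-* (suc n) x f =
    trans (cong (_+_ (x * f 0)) (∑<-distribˡ-* n x _)) (sym (*-distribˡ-+ x (f 0) _))

  neg-distrib-∑< : ∀ n (f : ℕ → ℤ) → ∑< n (λ i → - f i) ≡ - ∑< n f
  neg-distrib-∑< zero    f = refl
  neg-distrib-∑< (suc n) f = trans (cong (_+_ (- f 0)) (neg-distrib-∑< n _)) (sym (neg-distrib-+ (f 0) _))

  ∑<-split : ∀ m n (f : ℕ → ℤ) → ∑< (m +ℕ n) f ≡ ∑< m f + ∑< n (λ i → f (m +ℕ i))
  ∑<-split zero    n f = sym (+-identityˡ _)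
  ∑<-split (suc m) n f = trans (cong (_+_ (f 0)) (∑<-split m n _)) (sym (+-assoc (f 0) _ _))

  ∑<-truncate : ∀ {m n} (f : ℕ → ℤ) → m ≤ n → (∀ i → m ≤ i → i < n → f i ≡ 0ℤ) → ∑< n f ≡ ∑< m f
  ∑<-truncate {m} f m≤n tail≗0 with o , refl ← ℕ.m≤n⇒∃[o]m+o≡n m≤n = begin
    ∑< (m +ℕ o) f                            ≡⟨ ∑<-split m o f ⟩
    ∑< m f + ∑< o (λ i → f (m +ℕ i))         ≡⟨ cong (_+_ (∑< m f)) (∑<-≡0 o (λ i i<o →
                                                  tail≗0 (m +ℕ i) (ℕ.m≤m+n m i) (ℕ.+-monoʳ-< m i<o))) ⟩
    ∑< m f + 0ℤ                              ≡⟨ +-identityʳ _ ⟩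
    ∑< m f                                   ∎

  ∑<-sucʳ : ∀ n (f : ℕ → ℤ) → ∑< (suc n) f ≡ ∑< n f + f n
  ∑<-sucʳ zero    f = trans (+-identityʳ (f 0)) (sym (+-identityˡ (f 0)))
  ∑<-sucʳ (suc n) f = trans (cong (_+_ (f 0)) (∑<-sucʳ n _)) (sym (+-assoc (f 0) _ _))

  ∑<-reverse : ∀ n (f : ℕ → ℤ) → ∑< n f ≡ ∑< n (λ i → f (n ∸ suc i))
  ∑<-reverse zero    f = refl
  ∑<-reverse (suc n) f = begin
    ∑< (suc n) f                        ≡⟨ ∑<-sucʳ n f ⟩
    ∑< n f + f n                        ≡⟨ cong (_+ f n) (∑<-reverse n f) ⟩
    ∑< n (λ i → f (n ∸ suc i)) + f n    ≡⟨ +-comm _ (f n) ⟩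
    f n + ∑< n (λ i → f (n ∸ suc i))    ∎

  ∑<-reflect : ∀ e (f g : ℕ → ℤ) → (∀ s i → s +ℕ i ≡ e → f i ≡ g s) → ∑< (suc e) f ≡ ∑< (suc e) g
  ∑<-reflect e f g f≗g = trans (∑<-reverse (suc e) f)
    (∑<-cong (suc e) (λ { s (s≤s s≤e) → f≗g s (e ∸ s) (ℕ.m+[n∸m]≡n s≤e) }))

  ∑<-comm : ∀ m n (f : ℕ → ℕ → ℤ) → ∑< m (λ i → ∑< n (f i)) ≡ ∑< n (λ j → ∑< m (λ i → f i j))
  ∑<-comm zero    n f = sym (∑<-≡0 n (λ _ _ → refl))
  ∑<-comm (suc m) n f = trans (cong (_+_ (∑< n (f 0))) (∑<-comm m n (λ i → f (suc i))))
    (sym (∑<-distrib-+ n (f 0) (λ j → ∑< m (λ i → f (suc i) j))))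

  +m-+n≡+[m∸n] : ∀ {m n} → n ≤ m → + m - + n ≡ + (m ∸ n)
  +m-+n≡+[m∸n] {m} {n} n≤m = trans ([+m]-[+n]≡m⊖n m n) (⊖-≥ n≤m)

  binom-pascal : ∀ n y → binom (+ suc n) y ≡ binom (+ n) y + binom (+ n) (y - + 1)
  binom-pascal n (+ zero)    = refl
  binom-pascal n (+ suc m)   = cong +_ (trans (sym (nCk+nC[k+1]≡[n+1]C[k+1] n m)) (ℕ.+-comm (n C m) _))
  binom-pascal n -[1+ m ]    = refl

  m<n⇒binom[a][m-n]≡0 : ∀ a {m n} → m < n → binom (+ a) (+ m - + n) ≡ 0ℤ
  m<n⇒binom[a][m-n]≡0 a {m} {n} m<n rewrite [+m]-[+n]≡m⊖n m n | ⊖-< m<n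
    with n ∸ m | ℕ.m<n⇒0<n∸m m<n
  ... | suc _ | _ = refl

  ∑<-pascal : ∀ m (g : ℕ → ℤ) →
    ∑< (suc (suc m)) (λ i → + (suc m C i) * g i)
      ≡ ∑< (suc m) (λ i → + (m C i) * g i) + ∑< (suc m) (λ i → + (m C i) * g (suc i))
  ∑<-pascal m g = begin
    ∑< (suc (suc m)) (λ i → + (suc m C i) * g i)
      ≡⟨ cong (_+_ (+ 1 * g 0)) (trans (∑<-cong (suc m) (λ i _ → pascal i)) (∑<-distrib-+ (suc m) shifted upper)) ⟩
    + 1 * g 0 + (∑< (suc m) shifted + ∑< (suc m) upper)
      ≡⟨ regroup (+ 1 * g 0) (∑< (suc m) shifted) (∑< (suc m) upper) ⟩
    ∑< (suc (suc m)) term + ∑< (suc m) shifted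
      ≡⟨ cong (_+ ∑< (suc m) shifted) (trans (∑<-sucʳ (suc m) term) last≡0) ⟩
    ∑< (suc m) term + ∑< (suc m) shifted
      ∎
    where
    term shifted upper : ℕ → ℤ
    term    i = + (m C i) * g i
    shifted i = + (m C i) * g (suc i)
    upper   i = + (m C suc i) * g (suc i)
    pascal : ∀ i → + (suc m C suc i) * g (suc i) ≡ shifted i + upper i
    pascal i = trans (cong (λ x → + x * g (suc i)) (sym (nCk+nC[k+1]≡[n+1]C[k+1] m i)))
                     (*-distribʳ-+ (g (suc i)) (+ (m C i)) (+ (m C suc i)))
    regroup : ∀ (a x y : ℤ) → a + (x + y) ≡ (a + y) + x
    regroup = solve-∀
    last≡0 : ∑< (suc m) term + term (suc m) ≡ ∑< (suc m) term
    last≡0 rewrite k>n⇒nCk≡0 (ℕ.n<1+n m) = +-identityʳ (∑< (suc m) term)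

  binom-vandermonde : ∀ m a y → binom (+ (m +ℕ a)) y ≡ ∑< (suc m) (λ i → + (m C i) * binom (+ a) (y - + i))
  binom-vandermonde zero    a y = sym (trans (+-identityʳ _) (trans (*-identityˡ _) (cong (binom (+ a)) (+-identityʳ y))))
  binom-vandermonde (suc m) a y = begin
    binom (+ suc (m +ℕ a)) y
      ≡⟨ binom-pascal (m +ℕ a) y ⟩
    binom (+ (m +ℕ a)) y + binom (+ (m +ℕ a)) (y - + 1)
      ≡⟨ cong₂ _+_ (binom-vandermonde m a y) (binom-vandermonde m a (y - + 1)) ⟩
    ∑< (suc m) (λ i → + (m C i) * binom (+ a) (y - + i)) + ∑< (suc m) (λ i → + (m C i) * binom (+ a) (y - + 1 - + i))
      ≡⟨ cong (_+_ (∑< (suc m) (λ i → + (m C i) * binom (+ a) (y - + i))))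
              (∑<-cong (suc m) (λ i _ → cong (λ z → + (m C i) * binom (+ a) z) (sub-suc y (+ i)))) ⟩
    ∑< (suc m) (λ i → + (m C i) * binom (+ a) (y - + i)) + ∑< (suc m) (λ i → + (m C i) * binom (+ a) (y - + suc i))
      ≡⟨ ∑<-pascal m (λ i → binom (+ a) (y - + i)) ⟨
    ∑< (suc (suc m)) (λ i → + (suc m C i) * binom (+ a) (y - + i))
      ∎
    where
    sub-suc : ∀ (y i : ℤ) → y - + 1 - i ≡ y - (+ 1 + i)
    sub-suc = solve-∀

  [m+n]Cm*[m!*n!]≡[m+n]! : ∀ m n → ((m +ℕ n) C m) *ℕ (m ! *ℕ n !) ≡ (m +ℕ n) !
  [m+n]Cm*[m!*n!]≡[m+n]! m n =
    subst (λ k → ((m +ℕ n) C m) *ℕ (m ! *ℕ k !) ≡ (m +ℕ n) !) (ℕ.m+n∸m≡n m n)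
      (trans (cong (_*ℕ (m ! *ℕ (m +ℕ n ∸ m) !)) (nCk≡n!/k![n-k]! m≤m+n))
             (m/n*n≡m {{ℕ._!*_!≢0 m (m +ℕ n ∸ m)}} (k![n∸k]!∣n! m≤m+n)))
    where
    m≤m+n : m ≤ m +ℕ n
    m≤m+n = ℕ.m≤m+n m n

  nCr*[n∸r]Ci≡nC[r+i]*[r+i]Cr : ∀ {n} r i → r +ℕ i ≤ n →
    (n C r) *ℕ ((n ∸ r) C i) ≡ (n C (r +ℕ i)) *ℕ ((r +ℕ i) C r)
  nCr*[n∸r]Ci≡nC[r+i]*[r+i]Cr r i r+i≤n with t , refl ← ℕ.m≤n⇒∃[o]m+o≡n r+i≤n =
    ℕ.*-cancelʳ-≡ _ _ (r ! *ℕ (i ! *ℕ t !)) {{ℕ.m*n≢0 (r !) _ {{ℕ._!≢0 r}} {{ℕ._!*_!≢0 i t}}}} (begin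
      (n C r) *ℕ ((n ∸ r) C i) *ℕ (r ! *ℕ (i ! *ℕ t !))
        ≡⟨ cong₂ (λ u v → (u C r) *ℕ (v C i) *ℕ (r ! *ℕ (i ! *ℕ t !))) (ℕ.+-assoc r i t) n∸r≡i+t ⟩
      ((r +ℕ (i +ℕ t)) C r) *ℕ ((i +ℕ t) C i) *ℕ (r ! *ℕ (i ! *ℕ t !))
        ≡⟨ reassoc₁ ((r +ℕ (i +ℕ t)) C r) ((i +ℕ t) C i) (r !) (i !) (t !) ⟩
      ((r +ℕ (i +ℕ t)) C r) *ℕ (r ! *ℕ (((i +ℕ t) C i) *ℕ (i ! *ℕ t !)))
        ≡⟨ cong (λ x → ((r +ℕ (i +ℕ t)) C r) *ℕ (r ! *ℕ x)) ([m+n]Cm*[m!*n!]≡[m+n]! i t) ⟩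
      ((r +ℕ (i +ℕ t)) C r) *ℕ (r ! *ℕ (i +ℕ t) !)
        ≡⟨ [m+n]Cm*[m!*n!]≡[m+n]! r (i +ℕ t) ⟩
      (r +ℕ (i +ℕ t)) !
        ≡⟨ cong _! (ℕ.+-assoc r i t) ⟨
      n !
        ≡⟨ [m+n]Cm*[m!*n!]≡[m+n]! (r +ℕ i) t ⟨
      (n C (r +ℕ i)) *ℕ ((r +ℕ i) ! *ℕ t !)
        ≡⟨ cong (λ x → (n C (r +ℕ i)) *ℕ (x *ℕ t !)) ([m+n]Cm*[m!*n!]≡[m+n]! r i) ⟨
      (n C (r +ℕ i)) *ℕ ((((r +ℕ i) C r) *ℕ (r ! *ℕ i !)) *ℕ t !)
        ≡⟨ reassoc₂ (n C (r +ℕ i)) ((r +ℕ i) C r) (r !) (i !) (t !) ⟩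
      (n C (r +ℕ i)) *ℕ ((r +ℕ i) C r) *ℕ (r ! *ℕ (i ! *ℕ t !))
        ∎)
    where
    n = r +ℕ i +ℕ t
    n∸r≡i+t : n ∸ r ≡ i +ℕ t
    n∸r≡i+t = trans (cong (_∸ r) (ℕ.+-assoc r i t)) (ℕ.m+n∸m≡n r (i +ℕ t))
    reassoc₁ : ∀ a b x y z → a *ℕ b *ℕ (x *ℕ (y *ℕ z)) ≡ a *ℕ (x *ℕ (b *ℕ (y *ℕ z)))
    reassoc₁ = ℕ-Solver.solve-∀
    reassoc₂ : ∀ a b x y z → a *ℕ ((b *ℕ (x *ℕ y)) *ℕ z) ≡ a *ℕ b *ℕ (x *ℕ (y *ℕ z))
    reassoc₂ = ℕ-Solver.solve-∀

  ∑[-1]^r*sCr*[m∸r]C[q∸r]≡[m∸s]Cq : ∀ s m q → s ≤ m →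
    ∑< (suc q) (λ r → sgn r * + (s C r) * + ((m ∸ r) C (q ∸ r))) ≡ + ((m ∸ s) C q)
  ∑[-1]^r*sCr*[m∸r]C[q∸r]≡[m∸s]Cq zero m q _ =
    trans (cong₂ _+_ (*-identityˡ (+ (m C q))) (∑<-≡0 q (λ r _ → higher r))) (+-identityʳ _)
    where
    higher : ∀ r → sgn (suc r) * + (0 C suc r) * + ((m ∸ suc r) C (q ∸ suc r)) ≡ 0ℤ
    higher r rewrite *-zeroʳ (sgn (suc r)) = refl
  ∑[-1]^r*sCr*[m∸r]C[q∸r]≡[m∸s]Cq (suc s) (suc m) zero    _         = refl
  ∑[-1]^r*sCr*[m∸r]C[q∸r]≡[m∸s]Cq (suc s) (suc m) (suc q) (s≤s s≤m) = begin
    ∑< (suc (suc q)) (λ r → sgn r * + (suc s C r) * A (suc m) (suc q) r)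
      ≡⟨ cong (_+_ lead) (trans (∑<-cong (suc q) (λ r _ → pascal r)) (∑<-distrib-+ (suc q) upper lower)) ⟩
    lead + (∑< (suc q) upper + ∑< (suc q) lower)
      ≡⟨ +-assoc lead (∑< (suc q) upper) (∑< (suc q) lower) ⟨
    ∑< (suc (suc q)) (λ r → sgn r * + (s C r) * A (suc m) (suc q) r) + ∑< (suc q) lower
      ≡⟨ cong₂ _+_ (∑[-1]^r*sCr*[m∸r]C[q∸r]≡[m∸s]Cq s (suc m) (suc q) (ℕ.m≤n⇒m≤1+n s≤m))
                   (trans (neg-distrib-∑< (suc q) (λ r → sgn r * + (s C r) * A m q r))
                          (cong -_ (∑[-1]^r*sCr*[m∸r]C[q∸r]≡[m∸s]Cq s m q s≤m))) ⟩
    + ((suc m ∸ s) C suc q) - + ((m ∸ s) C q)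
      ≡⟨ cong (λ n → + (n C suc q) - + ((m ∸ s) C q)) (ℕ.+-∸-assoc 1 s≤m) ⟩
    + (suc (m ∸ s) C suc q) - + ((m ∸ s) C q)
      ≡⟨ cong (λ n → + n - + ((m ∸ s) C q)) (nCk+nC[k+1]≡[n+1]C[k+1] (m ∸ s) q) ⟨
    + ((m ∸ s) C q) + + ((m ∸ s) C suc q) - + ((m ∸ s) C q)
      ≡⟨ cancel (+ ((m ∸ s) C q)) (+ ((m ∸ s) C suc q)) ⟩
    + ((m ∸ s) C suc q)
      ∎
    where
    A : ℕ → ℕ → ℕ → ℤ
    A m q r = + ((m ∸ r) C (q ∸ r))
    lead : ℤ
    lead = sgn 0 * + (s C 0) * A (suc m) (suc q) 0
    upper lower : ℕ → ℤ
    upper r = sgn (suc r) * + (s C suc r) * A m q r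
    lower r = - (sgn r * + (s C r) * A m q r)
    pascal : ∀ r → sgn (suc r) * + (suc s C suc r) * A m q r ≡ upper r + lower r
    pascal r = trans (cong (λ n → sgn (suc r) * + n * A m q r) (sym (nCk+nC[k+1]≡[n+1]C[k+1] s r)))
                     (expand (sgn r) (+ (s C r)) (+ (s C suc r)) (A m q r))
      where
      expand : ∀ g u v a → (- g) * (u + v) * a ≡ (- g) * v * a + - (g * u * a)
      expand = solve-∀
    cancel : ∀ (a b : ℤ) → a + b - a ≡ b
    cancel = solve-∀

  weighted-vandermonde : ∀ {N r} A y → r ≤ N →
    + (N C r) * binom (+ (N ∸ r +ℕ A)) (y - + r)
      ≡ ∑< (suc N) (λ s → + (N C s) * + (s C r) * binom (+ A) (y - + s))
  weighted-vandermonde {N} {r} A y r≤N = begin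
    + (N C r) * binom (+ (N ∸ r +ℕ A)) (y - + r)
      ≡⟨ cong (_*_ (+ (N C r))) (binom-vandermonde (N ∸ r) A (y - + r)) ⟩
    + (N C r) * ∑< (suc (N ∸ r)) (λ i → + ((N ∸ r) C i) * binom (+ A) (y - + r - + i))
      ≡⟨ ∑<-distribˡ-* (suc (N ∸ r)) (+ (N C r)) (λ i → + ((N ∸ r) C i) * binom (+ A) (y - + r - + i)) ⟨
    ∑< (suc (N ∸ r)) (λ i → + (N C r) * (+ ((N ∸ r) C i) * binom (+ A) (y - + r - + i)))
      ≡⟨ ∑<-cong (suc (N ∸ r)) (λ { i (s≤s i≤N∸r) → merge i i≤N∸r }) ⟩
    ∑< (suc (N ∸ r)) (λ i → term (r +ℕ i))
      ≡⟨ +-identityˡ _ ⟨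
    0ℤ + ∑< (suc (N ∸ r)) (λ i → term (r +ℕ i))
      ≡⟨ cong (_+ ∑< (suc (N ∸ r)) (λ i → term (r +ℕ i))) (∑<-≡0 r below-r) ⟨
    ∑< r term + ∑< (suc (N ∸ r)) (λ i → term (r +ℕ i))
      ≡⟨ ∑<-split r (suc (N ∸ r)) term ⟨
    ∑< (r +ℕ suc (N ∸ r)) term
      ≡⟨ cong (λ n → ∑< n term) (trans (ℕ.+-suc r (N ∸ r)) (cong suc (ℕ.m+[n∸m]≡n r≤N))) ⟩
    ∑< (suc N) term
      ∎
    where
    term : ℕ → ℤ
    term s = + (N C s) * + (s C r) * binom (+ A) (y - + s)
    below-r : ∀ s → s < r → term s ≡ 0ℤ
    below-r s s<r rewrite k>n⇒nCk≡0 s<r | *-zeroʳ (+ (N C s)) = refl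
    sub-sub : ∀ (y r i : ℤ) → y - r - i ≡ y - (r + i)
    sub-sub = solve-∀
    merge : ∀ i → i ≤ N ∸ r →
      + (N C r) * (+ ((N ∸ r) C i) * binom (+ A) (y - + r - + i)) ≡ term (r +ℕ i)
    merge i i≤N∸r = begin
      + (N C r) * (+ ((N ∸ r) C i) * binom (+ A) (y - + r - + i))
        ≡⟨ *-assoc (+ (N C r)) (+ ((N ∸ r) C i)) (binom (+ A) (y - + r - + i)) ⟨
      + (N C r) * + ((N ∸ r) C i) * binom (+ A) (y - + r - + i)
        ≡⟨ cong₂ (λ n z → n * binom (+ A) z) choose-twice (sub-sub y (+ r) (+ i)) ⟩
      term (r +ℕ i)
        ∎
      where
      choose-twice : + (N C r) * + ((N ∸ r) C i) ≡ + (N C (r +ℕ i)) * + ((r +ℕ i) C r)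
      choose-twice = begin
        + (N C r) * + ((N ∸ r) C i)                ≡⟨ pos-* (N C r) ((N ∸ r) C i) ⟨
        + ((N C r) *ℕ ((N ∸ r) C i))               ≡⟨ cong +_ (nCr*[n∸r]Ci≡nC[r+i]*[r+i]Cr r i r+i≤N) ⟩
        + ((N C (r +ℕ i)) *ℕ ((r +ℕ i) C r))       ≡⟨ pos-* (N C (r +ℕ i)) ((r +ℕ i) C r) ⟩
        + (N C (r +ℕ i)) * + ((r +ℕ i) C r)        ∎
        where
        r+i≤N : r +ℕ i ≤ N
        r+i≤N = subst (r +ℕ i ≤_) (ℕ.m+[n∸m]≡n r≤N) (ℕ.+-monoʳ-≤ r i≤N∸r)

  -- The two sides of proposition2 in the variables N = c + d - k, A = p - c - d + 2k - 2,
  -- q = k - 1, m = c - 1 and t = ℓ - 1.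
  convolution-term alternating-term : (N A q m t : ℕ) → ℕ → ℤ
  convolution-term N A q m t s = + (N C s) * binom (+ A) (+ m - + t - + s) * + ((m ∸ s) C q)
  alternating-term N A q m t r =
    sgn r * + ((m ∸ r) C (q ∸ r)) * + (N C r) * binom (+ (N ∸ r +ℕ A)) (+ m - + t - + r)

  ∑<-convolution≡∑<-alternating : ∀ N q e A t → q +ℕ e ≤ N →
    ∑< (suc e) (convolution-term N A q (q +ℕ e) t) ≡ ∑< (suc q) (alternating-term N A q (q +ℕ e) t)
  ∑<-convolution≡∑<-alternating N q e A t m≤N = begin
    ∑< (suc e) (convolution-term N A q m t)
      ≡⟨ ∑<-truncate (convolution-term N A q m t) (s≤s e≤N) (λ s e<s _ → term-vanishes s e<s) ⟨
    ∑< (suc N) (convolution-term N A q m t)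
      ≡⟨ ∑<-cong (suc N) (λ s _ → alternating-inner-sum s) ⟨
    ∑< (suc N) (λ s → ∑< (suc q) (λ r → H r s))
      ≡⟨ ∑<-comm (suc N) (suc q) (λ s r → H r s) ⟩
    ∑< (suc q) (λ r → ∑< (suc N) (H r))
      ≡⟨ ∑<-cong (suc q) (λ { r (s≤s r≤q) → expand r r≤q }) ⟨
    ∑< (suc q) (alternating-term N A q m t)
      ∎
    where
    m : ℕ
    m = q +ℕ e
    y : ℤ
    y = + m - + t
    e≤N : e ≤ N
    e≤N = ℕ.≤-trans (ℕ.m≤n+m e q) m≤N
    X : ℕ → ℤ
    X s = + (N C s) * binom (+ A) (y - + s)
    G : ℕ → ℕ → ℤ
    G s r = sgn r * + (s C r) * + ((m ∸ r) C (q ∸ r))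
    H : ℕ → ℕ → ℤ
    H r s = X s * G s r
    X-vanishes : ∀ s → m < s → X s ≡ 0ℤ
    X-vanishes s m<s = begin
      + (N C s) * binom (+ A) (y - + s)       ≡⟨ cong (λ z → + (N C s) * binom (+ A) z) (sub-sub (+ m) (+ t) (+ s)) ⟩
      + (N C s) * binom (+ A) (+ m - + (t +ℕ s)) ≡⟨ cong (_*_ (+ (N C s))) (m<n⇒binom[a][m-n]≡0 A m<t+s) ⟩
      + (N C s) * 0ℤ                           ≡⟨ *-zeroʳ (+ (N C s)) ⟩
      0ℤ                                       ∎
      where
      sub-sub : ∀ (y r i : ℤ) → y - r - i ≡ y - (r + i)
      sub-sub = solve-∀
      m<t+s : m < t +ℕ s
      m<t+s = ℕ.<-≤-trans m<s (ℕ.m≤n+m s t)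
    term-vanishes : ∀ s → e < s → convolution-term N A q m t s ≡ 0ℤ
    term-vanishes s e<s with s ≤? m
    ... | yes s≤m = trans (cong (λ n → X s * + n) (k>n⇒nCk≡0 m∸s<q)) (*-zeroʳ (X s))
      where
      m∸s<q : m ∸ s < q
      m∸s<q = subst (m ∸ s <_) (ℕ.m+n∸n≡m q e) (ℕ.∸-monoʳ-< e<s s≤m)
    ... | no s≰m = cong (_* + ((m ∸ s) C q)) (X-vanishes s (ℕ.≰⇒> s≰m))
    alternating-inner-sum : ∀ s → ∑< (suc q) (λ r → H r s) ≡ convolution-term N A q m t s
    alternating-inner-sum s with s ≤? m
    ... | yes s≤m = trans (∑<-distribˡ-* (suc q) (X s) (G s)) (cong (_*_ (X s)) (∑[-1]^r*sCr*[m∸r]C[q∸r]≡[m∸s]Cq s m q s≤m))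
    ... | no s≰m = trans (∑<-≡0 (suc q) (λ r _ → cong (_* G s r) X≡0)) (sym (cong (_* + ((m ∸ s) C q)) X≡0))
      where
      X≡0 : X s ≡ 0ℤ
      X≡0 = X-vanishes s (ℕ.≰⇒> s≰m)
    expand : ∀ r → r ≤ q → alternating-term N A q m t r ≡ ∑< (suc N) (H r)
    expand r r≤q = begin
      sgn r * K * + (N C r) * binom (+ (N ∸ r +ℕ A)) (y - + r)
        ≡⟨ *-assoc (sgn r * K) (+ (N C r)) (binom (+ (N ∸ r +ℕ A)) (y - + r)) ⟩
      sgn r * K * (+ (N C r) * binom (+ (N ∸ r +ℕ A)) (y - + r))
        ≡⟨ cong (_*_ (sgn r * K)) (weighted-vandermonde A y r≤N) ⟩
      sgn r * K * ∑< (suc N) (λ s → + (N C s) * + (s C r) * binom (+ A) (y - + s))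
        ≡⟨ ∑<-distribˡ-* (suc N) (sgn r * K) (λ s → + (N C s) * + (s C r) * binom (+ A) (y - + s)) ⟨
      ∑< (suc N) (λ s → sgn r * K * (+ (N C s) * + (s C r) * binom (+ A) (y - + s)))
        ≡⟨ ∑<-cong (suc N) (λ s _ → rearrange (sgn r) K (+ (N C s)) (+ (s C r)) (binom (+ A) (y - + s))) ⟩
      ∑< (suc N) (H r)
        ∎
      where
      K : ℤ
      K = + ((m ∸ r) C (q ∸ r))
      r≤N : r ≤ N
      r≤N = ℕ.≤-trans (ℕ.≤-trans r≤q (ℕ.m≤m+n q e)) m≤N
      rearrange : ∀ g k n c b → g * k * (n * c * b) ≡ n * b * (g * c * k)
      rearrange = solve-∀

  Cfun-summand RHS-summand : ℕ → ℕ → ℕ → ℕ → ℕ → ℕ → ℤ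
  Cfun-summand p c d k ℓ j =
    binom (+ k + + j - + 2) (+ k - + 1)
    * binom (+ c + + d - + k) (+ d + + j - + 1)
    * binom (+ p - + c - + d + + 2 * + k - + 2) (+ k + + j - + 1 - + ℓ)
  RHS-summand p c d k ℓ r =
    sgn r
    * binom (+ c - + 1 - + r) (+ k - + 1 - + r)
    * binom (+ c + + d - + k) (+ r)
    * binom (+ p + + k - + r - + 2) (+ c - + ℓ - + r)

  Cfun-summand-reflected : ∀ q d h t s i e → s +ℕ i ≡ e →
    Cfun-summand (suc (q +ℕ e) +ℕ d +ℕ h) (suc (q +ℕ e)) d (suc q) (suc t) (suc i)
      ≡ convolution-term (e +ℕ d) (h +ℕ (q +ℕ q)) q (q +ℕ e) t s
  Cfun-summand-reflected q d h t s i .(s +ℕ i) refl = begin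
    Cfun-summand (suc (q +ℕ e) +ℕ d +ℕ h) (suc (q +ℕ e)) d (suc q) (suc t) (suc i)
      ≡⟨ cong₂ _*_ (cong₂ _*_ (cong₂ binom (lower-a Q I) (lower-b Q))
                              (trans (cong₂ binom (middle-a Q E D) (middle-b D I)) (cong +_ symmetry)))
                   (cong₂ binom (upper-a Q E D H) (upper-b Q S I T)) ⟩
    + ((q +ℕ i) C q) * + (N C s) * binom (+ A) (+ (q +ℕ e) - + t - + s)
      ≡⟨ rotate (+ ((q +ℕ i) C q)) (+ (N C s)) (binom (+ A) (+ (q +ℕ e) - + t - + s)) ⟩
    + (N C s) * binom (+ A) (+ (q +ℕ e) - + t - + s) * + ((q +ℕ i) C q)
      ≡⟨ cong (λ n → + (N C s) * binom (+ A) (+ (q +ℕ e) - + t - + s) * + (n C q)) q+e∸s≡q+i ⟨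
    convolution-term N A q (q +ℕ e) t s
      ∎
    where
    e N A : ℕ
    e = s +ℕ i
    N = e +ℕ d
    A = h +ℕ (q +ℕ q)
    Q E D H S I T : ℤ
    Q = + q
    E = + e
    D = + d
    H = + h
    S = + s
    I = + i
    T = + t
    lower-a : ∀ Q I → (+ 1 + Q) + (+ 1 + I) - + 2 ≡ Q + I
    lower-a = solve-∀
    lower-b : ∀ Q → (+ 1 + Q) - + 1 ≡ Q
    lower-b = solve-∀
    middle-a : ∀ Q E D → (+ 1 + Q + E) + D - (+ 1 + Q) ≡ E + D
    middle-a = solve-∀
    middle-b : ∀ D I → D + (+ 1 + I) - + 1 ≡ D + I
    middle-b = solve-∀
    upper-a : ∀ Q E D H → (+ 1 + Q + E) + D + H - (+ 1 + Q + E) - D + + 2 * (+ 1 + Q) - + 2 ≡ H + (Q + Q)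
    upper-a = solve-∀
    upper-b : ∀ Q S I T → (+ 1 + Q) + (+ 1 + I) - + 1 - (+ 1 + T) ≡ Q + (S + I) - T - S
    upper-b = solve-∀
    rotate : ∀ x y z → x * y * z ≡ y * z * x
    rotate = solve-∀
    N≡s+[d+i] : N ≡ s +ℕ (d +ℕ i)
    N≡s+[d+i] = trans (ℕ.+-assoc s i d) (cong (s +ℕ_) (ℕ.+-comm i d))
    symmetry : N C (d +ℕ i) ≡ N C s
    symmetry = trans (nCk≡nC[n∸k] (subst (d +ℕ i ≤_) (sym N≡s+[d+i]) (ℕ.m≤n+m (d +ℕ i) s)))
                     (cong (N C_) (trans (cong (_∸ (d +ℕ i)) N≡s+[d+i]) (ℕ.m+n∸n≡m s (d +ℕ i))))
    q+e∸s≡q+i : q +ℕ e ∸ s ≡ q +ℕ i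
    q+e∸s≡q+i = trans (cong (λ n → q +ℕ n ∸ s) (ℕ.+-comm s i))
                      (trans (cong (_∸ s) (sym (ℕ.+-assoc q i s))) (ℕ.m+n∸n≡m (q +ℕ i) s))

  RHS-summand-normalised : ∀ q e d h t r → r ≤ q → q +ℕ e ≤ e +ℕ d →
    RHS-summand (suc (q +ℕ e) +ℕ d +ℕ h) (suc (q +ℕ e)) d (suc q) (suc t) r
      ≡ alternating-term (e +ℕ d) (h +ℕ (q +ℕ q)) q (q +ℕ e) t r
  RHS-summand-normalised q e d h t r r≤q q+e≤N =
    cong₂ _*_ (cong₂ _*_ (cong (_*_ (sgn r)) (cong₂ binom top bottom))
                         (cong (λ z → binom z (+ r)) (middle Q E D)))
              (cong₂ binom (trans (upper-a Q E D H R) (cong (_+ + (h +ℕ (q +ℕ q))) (+m-+n≡+[m∸n] r≤N)))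
                           (upper-b Q E T R))
    where
    Q E D H T R : ℤ
    Q = + q
    E = + e
    D = + d
    H = + h
    T = + t
    R = + r
    r≤N : r ≤ e +ℕ d
    r≤N = ℕ.≤-trans (ℕ.≤-trans r≤q (ℕ.m≤m+n q e)) q+e≤N
    sub-one : ∀ X R → (+ 1 + X) - + 1 - R ≡ X - R
    sub-one = solve-∀
    top : + suc (q +ℕ e) - + 1 - R ≡ + (q +ℕ e ∸ r)
    top = trans (sub-one (Q + E) R) (+m-+n≡+[m∸n] (ℕ.≤-trans r≤q (ℕ.m≤m+n q e)))
    bottom : + suc q - + 1 - R ≡ + (q ∸ r)
    bottom = trans (sub-one Q R) (+m-+n≡+[m∸n] r≤q)
    middle : ∀ Q E D → (+ 1 + Q + E) + D - (+ 1 + Q) ≡ E + D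
    middle = solve-∀
    upper-a : ∀ Q E D H R → (+ 1 + Q + E) + D + H + (+ 1 + Q) - R - + 2 ≡ (E + D - R) + (H + (Q + Q))
    upper-a = solve-∀
    upper-b : ∀ Q E T R → (+ 1 + Q + E) - (+ 1 + T) - R ≡ Q + E - T - R
    upper-b = solve-∀

  Cfun-normalised : ∀ q e d h t →
    Cfun (suc (q +ℕ e) +ℕ d +ℕ h) (suc (q +ℕ e)) d (suc q) (suc t)
      ≡ ∑< (suc e) (convolution-term (e +ℕ d) (h +ℕ (q +ℕ q)) q (q +ℕ e) t)
  Cfun-normalised q e d h t = begin
    Cfun p c d (suc q) (suc t)
      ≡⟨ sumFromTo≡∑< 1 (suc c ∸ suc q) (Cfun-summand p c d (suc q) (suc t)) ⟩
    ∑< (suc c ∸ suc q) summand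
      ≡⟨ cong (λ n → ∑< n summand) (trans (cong (_∸ q) (sym (ℕ.+-suc q e))) (ℕ.m+n∸m≡n q (suc e))) ⟩
    ∑< (suc e) summand
      ≡⟨ ∑<-reflect e summand (convolution-term (e +ℕ d) (h +ℕ (q +ℕ q)) q (q +ℕ e) t)
                    (λ s i s+i≡e → Cfun-summand-reflected q d h t s i e s+i≡e) ⟩
    ∑< (suc e) (convolution-term (e +ℕ d) (h +ℕ (q +ℕ q)) q (q +ℕ e) t)
      ∎
    where
    c p : ℕ
    c = suc (q +ℕ e)
    p = c +ℕ d +ℕ h
    summand : ℕ → ℤ
    summand i = Cfun-summand p c d (suc q) (suc t) (suc i)

  RHS-normalised : ∀ q e d h t → q +ℕ e ≤ e +ℕ d →
    RHS (suc (q +ℕ e) +ℕ d +ℕ h) (suc (q +ℕ e)) d (suc q) (suc t)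
      ≡ ∑< (suc q) (alternating-term (e +ℕ d) (h +ℕ (q +ℕ q)) q (q +ℕ e) t)
  RHS-normalised q e d h t q+e≤N =
    trans (sumFromTo≡∑< 0 q (RHS-summand (suc (q +ℕ e) +ℕ d +ℕ h) (suc (q +ℕ e)) d (suc q) (suc t)))
          (∑<-cong (suc q) (λ { r (s≤s r≤q) → RHS-summand-normalised q e d h t r r≤q q+e≤N }))

open import Data.Nat using (ℕ; suc; z≤n; s≤s; _+_; _≤_; _<_; _∸_)
open import Data.Nat.Properties using (m≤n⇒∃[o]m+o≡n; ≤-trans; n≤1+n; m≤n+m)
open import Data.Nat.Primality using (Prime)
open import Data.Product using (_,_)
open import Relation.Binary.PropositionalEquality using (_≡_; refl; trans; sym)

proposition2 : (p k c d : ℕ) → Prime p → 1 ≤ k → k ≤ c → c ≤ d → d < c + d → c + d ≤ p →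
    (ℓ : ℕ) → 1 ≤ ℓ → ℓ ≤ c + d + 1 ∸ k →
    Cfun p c d k ℓ ≡ RHS p c d k ℓ
proposition2 p (suc q) c d _ (s≤s z≤n) k≤c c≤d _ c+d≤p (suc t) (s≤s z≤n) _
  with e , refl ← m≤n⇒∃[o]m+o≡n k≤c
  with h , refl ← m≤n⇒∃[o]m+o≡n c+d≤p =
  trans (Cfun-normalised q e d h t)
        (trans (∑<-convolution≡∑<-alternating (e + d) q e (h + (q + q)) t q+e≤e+d)
               (sym (RHS-normalised q e d h t q+e≤e+d)))
  where
  q+e≤e+d : q + e ≤ e + d
  q+e≤e+d = ≤-trans (n≤1+n (q + e)) (≤-trans c≤d (m≤n+m d e))
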